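{- Let $n\ge 2$, $0<p<1/2$, $0\le q<1/2$. Let $G_1$ be a random undirected Erdős–Rényi graph on $\{1,\dots,n\}$ (symmetric $0/1$ adjacency matrix with zero diagonal, entries $G_1(i,j)$, $i<j$, i.i.d. Bernoulli$(p)$). Let $\tilde G_1$ be obtained from $G_1$ by flipping each entry $G_1(i,j)$, $i<j$ (and symmetrically $G_1(j,i)$), independently with probability $q$. Let $P$ be a fixed $n\times n$ permutation matrix and $G_2=P\tilde G_1P^T$. Let $s_1>s_2>s_3>0$, $\gamma=(s_2-s_3)/(s_1+s_2-2s_3)$ and, for an $n\times n$ permutation matrix $X$, $$F(X)=\mathrm{Tr}(G_1XG_2X^T)-\gamma\big(\mathrm{Tr}(G_1X\mathbb{1}X^T)+\mathrm{Tr}(\mathbb{1}XG_2X^T)\big).$$ Then $X=P^T$ (mapping each node of $G_1$ to its image under $P$) maximizes $\mathbb{E}[F(X)]$ over all $n\times n$ permutation matrices $X$, the expectation being over realizations of $G_1$ and $G_2$.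
   Context: $\mathbb{1}$ is the $n\times n$ all-ones matrix. $X(i,j')=1$ means node $i$ of $G_1$ is aligned to node $j'$ of $G_2$.
   Formalization: The parameters p, q, s₁, s₂ and s₃ range over the rationals. -}

module Defs where

open import Data.Nat using (ℕ; zero; suc; _<ᵇ_)
open import Data.Fin using (Fin; toℕ; _≟_)
open import Data.Bool using (Bool; true; false; if_then_else_; _xor_)
open import Data.Rational using (ℚ; 0ℚ; 1ℚ; _+_; _*_; _-_; _÷_; ≢-nonZero)
import Data.Rational as Q
open import Data.Vec.Functional using (_∷_)
open import Data.Fin.Permutation using (Permutation′; _⟨$⟩ʳ_)
open import Relation.Nullary using (yes; no)

Mat : ℕ → Set
Mat n = Fin n → Fin n → ℚ

Σ : ∀ {n} → (Fin n → ℚ) → ℚ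
Σ {zero}  f = 0ℚ
Σ {suc n} f = f Fin.zero + Σ (λ i → f (Fin.suc i))
  where import Data.Fin as Fin

_⊗_ : ∀ {n} → Mat n → Mat n → Mat n
(A ⊗ B) i j = Σ (λ k → A i k * B k j)
infixl 7 _⊗_

_ᵀ : ∀ {n} → Mat n → Mat n
(A ᵀ) i j = A j i

Tr : ∀ {n} → Mat n → ℚ
Tr A = Σ (λ i → A i i)

𝟙 : ∀ {n} → Mat n
𝟙 i j = 1ℚ

-- permutation matrix of π : X(i,j) = 1 iff j = π(i)  (node i aligned to node π(i))
permMat : ∀ {n} → Permutation′ n → Mat n
permMat π i j with (π ⟨$⟩ʳ i) ≟ j
... | yes _ = 1ℚ
... | no  _ = 0ℚ

b2q : Bool → ℚ
b2q b = if b then 1ℚ else 0ℚ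

-- symmetric 0/1 matrix with zero diagonal built from the strictly upper
-- triangular entries (i < j) of a Boolean array
symUpper : ∀ {n} → (Fin n → Fin n → Bool) → Mat n
symUpper b i j =
  if toℕ i <ᵇ toℕ j then b2q (b i j)
  else (if toℕ j <ᵇ toℕ i then b2q (b j i) else 0ℚ)

G₁ : ∀ {n} → (Fin n → Fin n → Bool) → Mat n
G₁ b = symUpper b

G̃₁ : ∀ {n} → (Fin n → Fin n → Bool) → (Fin n → Fin n → Bool) → Mat n
G̃₁ b c = symUpper (λ i j → b i j xor c i j)

G₂ : ∀ {n} → Mat n → (Fin n → Fin n → Bool) → (Fin n → Fin n → Bool) → Mat n
G₂ P b c = P ⊗ G̃₁ b c ⊗ (P ᵀ)

-- γ = a / d  (returns 0 when d = 0; never happens under s₁ > s₂ > s₃ > 0)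
safeDiv : ℚ → ℚ → ℚ
safeDiv a d with d Q.≟ 0ℚ
... | yes _  = 0ℚ
... | no d≢0 = _÷_ a d {{≢-nonZero d≢0}}

γ : ℚ → ℚ → ℚ → ℚ
γ s₁ s₂ s₃ = safeDiv (s₂ - s₃) ((s₁ + s₂) - (s₃ + s₃))

F : ∀ {n} → ℚ → Mat n → Mat n → Mat n → ℚ
F g A B X = Tr (A ⊗ X ⊗ B ⊗ (X ᵀ)) - g * (Tr (A ⊗ X ⊗ 𝟙 ⊗ (X ᵀ)) + Tr (𝟙 ⊗ X ⊗ B ⊗ (X ᵀ)))

EBern : ∀ k → ℚ → ((Fin k → Bool) → ℚ) → ℚ
EBern zero    p f = f (λ ())
EBern (suc k) p f = p * EBern k p (λ v → f (true ∷ v)) + (1ℚ - p) * EBern k p (λ v → f (false ∷ v))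

EArr : ∀ r m → ℚ → ((Fin r → Fin m → Bool) → ℚ) → ℚ
EArr zero    m p f = f (λ ())
EArr (suc r) m p f = EBern m p (λ row → EArr r m p (λ rest → f (row ∷ rest)))

EF : ∀ n → (p q s₁ s₂ s₃ : ℚ) → (P : Mat n) → Mat n → ℚ
EF n p q s₁ s₂ s₃ P X =
  EArr n n p (λ b → EArr n n q (λ c → F (γ s₁ s₂ s₃) (G₁ b) (G₂ P b c) X))

-- For a permutation matrix X of ρ, the two γ-terms of F(X) are the total edge counts of G₁
-- and G₂, which do not depend on ρ; so only 𝔼 Tr(G₁ X G₂ Xᵀ) matters.  With G₂ = P G̃₁ Pᵀ and
-- P the matrix of σ, this is the sum over node pairs (i, k) of the probability that {i, k} is
-- an edge of G₁ and {σρk, σρi} an edge of G̃₁.  That probability is p(1 − q) when the two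
-- pairs are the same edge, p (p(1 − q) + (1 − p) q) when they are distinct (the entries are
-- independent), and 0 when i = k.  As q ≤ ½ the first value is the largest, and ρ = σ⁻¹, i.e.
-- X = Pᵀ, is exactly the choice that makes every pair the same edge.
module Submission where

open import Defs
open import Data.Nat using (ℕ; zero; suc; _≤_; _<ᵇ_)
import Data.Nat.Properties as ℕ
open import Data.Fin using (Fin; zero; suc; toℕ; _≟_)
open import Data.Fin.Permutation using (Permutation′; _⟨$⟩ʳ_; _⟨$⟩ˡ_; inverseˡ; inverseʳ; flip)
open import Data.Rational using (ℚ; 0ℚ; 1ℚ; ½; _+_; _*_; _-_; -_; _<_; nonNegative)
import Data.Rational as Q
import Data.Rational.Properties as ℚ
open import Data.Rational.Solver using (module +-*-Solver)
open import Algebra.Properties.CommutativeMonoid.Sum ℚ.+-0-commutativeMonoid using (sum; sum-permute)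
open import Data.Bool using (Bool; true; false; T; _xor_; if_then_else_)
open import Data.Maybe using (Maybe; just; nothing)
open import Data.Empty using (⊥-elim)
open import Data.Product using (_×_; _,_)
open import Data.Product.Properties using () renaming (≡-dec to ×-≡-dec)
open import Data.Vec.Functional using (_∷_)
open import Function using (_∘_)
open import Relation.Nullary using (¬_; yes; no)
open import Relation.Nullary.Decidable using (from-yes)
open import Relation.Binary.PropositionalEquality

Σ-cong : ∀ {n} {f g : Fin n → ℚ} → (∀ i → f i ≡ g i) → Σ f ≡ Σ g
Σ-cong {zero}  f≗g = refl
Σ-cong {suc n} f≗g = cong₂ _+_ (f≗g zero) (Σ-cong (f≗g ∘ suc))

Σ-mono : ∀ {n} {f g : Fin n → ℚ} → (∀ i → f i Q.≤ g i) → Σ f Q.≤ Σ g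
Σ-mono {zero}  f≤g = ℚ.≤-refl
Σ-mono {suc n} f≤g = ℚ.+-mono-≤ (f≤g zero) (Σ-mono (f≤g ∘ suc))

Σ-zero : ∀ n → Σ {n} (λ _ → 0ℚ) ≡ 0ℚ
Σ-zero zero    = refl
Σ-zero (suc n) = cong (0ℚ +_) (Σ-zero n)

Σ≡sum : ∀ {n} (f : Fin n → ℚ) → Σ f ≡ sum f
Σ≡sum {zero}  f = refl
Σ≡sum {suc n} f = cong (f zero +_) (Σ≡sum (f ∘ suc))

Σ-permute : ∀ {n} (ρ : Permutation′ n) (f : Fin n → ℚ) → Σ f ≡ Σ (λ i → f (ρ ⟨$⟩ʳ i))
Σ-permute ρ f = begin
  Σ f                       ≡⟨ Σ≡sum f ⟩
  sum f                     ≡⟨ sum-permute f ρ ⟩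
  sum (λ i → f (ρ ⟨$⟩ʳ i))  ≡⟨ Σ≡sum (λ i → f (ρ ⟨$⟩ʳ i)) ⟨
  Σ (λ i → f (ρ ⟨$⟩ʳ i))    ∎
  where open ≡-Reasoning

δ : ∀ {n} → Fin n → Fin n → ℚ
δ a j with a ≟ j
... | yes _ = 1ℚ
... | no  _ = 0ℚ

δ-suc : ∀ {n} (a j : Fin n) → δ (suc a) (suc j) ≡ δ a j
δ-suc a j with a ≟ j
... | yes _ = refl
... | no  _ = refl

δ-permute : ∀ {n} (ρ : Permutation′ n) i j → δ (ρ ⟨$⟩ʳ i) j ≡ δ (ρ ⟨$⟩ˡ j) i
δ-permute ρ i j with ρ ⟨$⟩ʳ i ≟ j | ρ ⟨$⟩ˡ j ≟ i
... | yes _    | yes _      = refl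
... | no  _    | no  _      = refl
... | yes ρi≡j | no ρ⁻¹j≢i  =
  ⊥-elim (ρ⁻¹j≢i (trans (cong (ρ ⟨$⟩ˡ_) (sym ρi≡j)) (inverseˡ ρ)))
... | no ρi≢j  | yes ρ⁻¹j≡i =
  ⊥-elim (ρi≢j (trans (cong (ρ ⟨$⟩ʳ_) (sym ρ⁻¹j≡i)) (inverseʳ ρ)))

Σ-δʳ : ∀ {n} (f : Fin n → ℚ) c → Σ (λ j → f j * δ c j) ≡ f c
Σ-δʳ {suc n} f zero = begin
  f zero * 1ℚ + Σ (λ j → f (suc j) * 0ℚ)
    ≡⟨ cong₂ _+_ (ℚ.*-identityʳ (f zero)) (Σ-cong (λ j → ℚ.*-zeroʳ (f (suc j)))) ⟩
  f zero + Σ {n} (λ _ → 0ℚ)  ≡⟨ cong (f zero +_) (Σ-zero n) ⟩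
  f zero + 0ℚ                ≡⟨ ℚ.+-identityʳ (f zero) ⟩
  f zero                     ∎
  where open ≡-Reasoning
Σ-δʳ {suc n} f (suc c) = begin
  f zero * 0ℚ + Σ (λ j → f (suc j) * δ (suc c) (suc j))
    ≡⟨ cong₂ _+_ (ℚ.*-zeroʳ (f zero)) (Σ-cong (λ j → cong (f (suc j) *_) (δ-suc c j))) ⟩
  0ℚ + Σ (λ j → f (suc j) * δ c j)  ≡⟨ ℚ.+-identityˡ (Σ (λ j → f (suc j) * δ c j)) ⟩
  Σ (λ j → f (suc j) * δ c j)       ≡⟨ Σ-δʳ (f ∘ suc) c ⟩
  f (suc c)                         ∎
  where open ≡-Reasoning

Σ-δˡ : ∀ {n} (f : Fin n → ℚ) c → Σ (λ j → δ c j * f j) ≡ f c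
Σ-δˡ f c = trans (Σ-cong (λ j → ℚ.*-comm (δ c j) (f j))) (Σ-δʳ f c)

record IsPermMat {n} (ρ : Permutation′ n) (X : Mat n) : Set where
  constructor isPermMat
  field entry : ∀ i j → X i j ≡ δ (ρ ⟨$⟩ʳ i) j
open IsPermMat

permMat-isPermMat : ∀ {n} (ρ : Permutation′ n) → IsPermMat ρ (permMat ρ)
permMat-isPermMat ρ = isPermMat entry′
  where
  entry′ : ∀ i j → permMat ρ i j ≡ δ (ρ ⟨$⟩ʳ i) j
  entry′ i j with ρ ⟨$⟩ʳ i ≟ j
  ... | yes _ = refl
  ... | no  _ = refl

ᵀ-isPermMat : ∀ {n} {ρ : Permutation′ n} {X : Mat n} → IsPermMat ρ X → IsPermMat (flip ρ) (X ᵀ)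
ᵀ-isPermMat {ρ = ρ} X≐ρ = isPermMat λ i j → trans (entry X≐ρ j i) (δ-permute ρ j i)

module _ {n} {ρ : Permutation′ n} {X : Mat n} (X≐ρ : IsPermMat ρ X) (A : Mat n) where

  permMat-⊗ : ∀ i j → (X ⊗ A) i j ≡ A (ρ ⟨$⟩ʳ i) j
  permMat-⊗ i j =
    trans (Σ-cong (λ m → cong (_* A m j) (entry X≐ρ i m))) (Σ-δˡ (λ m → A m j) (ρ ⟨$⟩ʳ i))

  ⊗-permMatᵀ : ∀ i j → (A ⊗ X ᵀ) i j ≡ A i (ρ ⟨$⟩ʳ j)
  ⊗-permMatᵀ i j =
    trans (Σ-cong (λ m → cong (A i m *_) (entry X≐ρ j m))) (Σ-δʳ (A i) (ρ ⟨$⟩ʳ j))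

⊗-permMat : ∀ {n} {ρ : Permutation′ n} {X : Mat n} → IsPermMat ρ X →
  ∀ (A : Mat n) i j → (A ⊗ X) i j ≡ A i (ρ ⟨$⟩ˡ j)
⊗-permMat X≐ρ = ⊗-permMatᵀ (ᵀ-isPermMat X≐ρ)

conj-permMat : ∀ {n} {σ : Permutation′ n} {P : Mat n} → IsPermMat σ P →
  ∀ G k l → (P ⊗ G ⊗ P ᵀ) k l ≡ G (σ ⟨$⟩ʳ k) (σ ⟨$⟩ʳ l)
conj-permMat {σ = σ} {P} P≐σ G k l =
  trans (⊗-permMatᵀ P≐σ (P ⊗ G) k l) (permMat-⊗ P≐σ G k (σ ⟨$⟩ʳ l))

edgeOverlap : ∀ {n} → Permutation′ n → Mat n → Mat n → ℚ
edgeOverlap ρ A B = Σ λ i → Σ λ k → A i k * B (ρ ⟨$⟩ʳ k) (ρ ⟨$⟩ʳ i)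

entrySum : ∀ {n} → Mat n → ℚ
entrySum A = Σ λ i → Σ λ k → A i k

Tr-conj-permMat : ∀ {n} {ρ : Permutation′ n} {X : Mat n} → IsPermMat ρ X →
  ∀ A B → Tr (A ⊗ X ⊗ B ⊗ X ᵀ) ≡ edgeOverlap ρ A B
Tr-conj-permMat {ρ = ρ} {X} X≐ρ A B = Σ-cong λ i → begin
  (A ⊗ X ⊗ B ⊗ X ᵀ) i i
    ≡⟨ ⊗-permMatᵀ X≐ρ (A ⊗ X ⊗ B) i i ⟩
  Σ (λ m → (A ⊗ X) i m * B m (ρ ⟨$⟩ʳ i))
    ≡⟨ Σ-cong (λ m → cong (_* B m (ρ ⟨$⟩ʳ i)) (⊗-permMat X≐ρ A i m)) ⟩
  Σ (λ m → A i (ρ ⟨$⟩ˡ m) * B m (ρ ⟨$⟩ʳ i))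
    ≡⟨ Σ-permute ρ _ ⟩
  Σ (λ k → A i (ρ ⟨$⟩ˡ (ρ ⟨$⟩ʳ k)) * B (ρ ⟨$⟩ʳ k) (ρ ⟨$⟩ʳ i))
    ≡⟨ Σ-cong (λ k → cong (λ l → A i l * B (ρ ⟨$⟩ʳ k) (ρ ⟨$⟩ʳ i)) (inverseˡ ρ)) ⟩
  Σ (λ k → A i k * B (ρ ⟨$⟩ʳ k) (ρ ⟨$⟩ʳ i))
    ∎
  where open ≡-Reasoning

edgeOverlap-𝟙ʳ : ∀ {n} (ρ : Permutation′ n) A → edgeOverlap ρ A 𝟙 ≡ entrySum A
edgeOverlap-𝟙ʳ ρ A = Σ-cong λ i → Σ-cong λ k → ℚ.*-identityʳ (A i k)

edgeOverlap-𝟙ˡ : ∀ {n} (ρ : Permutation′ n) B → edgeOverlap ρ 𝟙 B ≡ entrySum (B ᵀ)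
edgeOverlap-𝟙ˡ ρ B = begin
  Σ (λ i → Σ λ k → 1ℚ * B (ρ ⟨$⟩ʳ k) (ρ ⟨$⟩ʳ i))
    ≡⟨ Σ-cong (λ i → Σ-cong λ k → ℚ.*-identityˡ (B (ρ ⟨$⟩ʳ k) (ρ ⟨$⟩ʳ i))) ⟩
  Σ (λ i → Σ λ k → B (ρ ⟨$⟩ʳ k) (ρ ⟨$⟩ʳ i))
    ≡⟨ Σ-cong (λ i → Σ-permute ρ (λ k → B k (ρ ⟨$⟩ʳ i))) ⟨
  Σ (λ i → Σ λ k → B k (ρ ⟨$⟩ʳ i))
    ≡⟨ Σ-permute ρ (λ j → Σ λ k → B k j) ⟨
  Σ (λ j → Σ λ k → B k j)
    ∎
  where open ≡-Reasoning

F-permMat : ∀ {n} {ρ : Permutation′ n} {X : Mat n} → IsPermMat ρ X →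
  ∀ g A B → F g A B X ≡ edgeOverlap ρ A B - g * (entrySum A + entrySum (B ᵀ))
F-permMat {ρ = ρ} X≐ρ g A B = cong₂ (λ t s → t - g * s)
  (Tr-conj-permMat X≐ρ A B)
  (cong₂ _+_ (trans (Tr-conj-permMat X≐ρ A 𝟙) (edgeOverlap-𝟙ʳ ρ A))
             (trans (Tr-conj-permMat X≐ρ 𝟙 B) (edgeOverlap-𝟙ˡ ρ B)))

record IsExpectation {Ω : Set} (E : (Ω → ℚ) → ℚ) : Set where
  field
    E-cong  : ∀ {f g} → (∀ ω → f ω ≡ g ω) → E f ≡ E g
    E-const : ∀ c → E (λ _ → c) ≡ c
    E-+     : ∀ f g → E (λ ω → f ω + g ω) ≡ E f + E g
    E-*ˡ    : ∀ c f → E (λ ω → c * f ω) ≡ c * E f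

  E-*ʳ : ∀ c f → E (λ ω → f ω * c) ≡ E f * c
  E-*ʳ c f = trans (E-cong (λ ω → ℚ.*-comm (f ω) c)) (trans (E-*ˡ c f) (ℚ.*-comm c (E f)))

  E-Σ : ∀ {n} (f : Fin n → Ω → ℚ) → E (λ ω → Σ λ i → f i ω) ≡ Σ λ i → E (f i)
  E-Σ {zero}  f = E-const 0ℚ
  E-Σ {suc n} f = trans (E-+ (f zero) _) (cong (E (f zero) +_) (E-Σ (f ∘ suc)))

  E-minus-* : ∀ f c h → E (λ ω → f ω - c * h ω) ≡ E f - c * E h
  E-minus-* f c h = begin
    E (λ ω → f ω - c * h ω)    ≡⟨ E-cong (λ ω → cong (f ω +_) (ℚ.neg-distribˡ-* c (h ω))) ⟩
    E (λ ω → f ω + - c * h ω)  ≡⟨ E-+ f _ ⟩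
    E f + E (λ ω → - c * h ω)  ≡⟨ cong (E f +_) (E-*ˡ (- c) h) ⟩
    E f + - c * E h            ≡⟨ cong (E f +_) (ℚ.neg-distribˡ-* c (E h)) ⟨
    E f - c * E h              ∎
    where open ≡-Reasoning
open IsExpectation

module _ {n} {Ω : Set} {E : (Ω → ℚ) → ℚ} (isE : IsExpectation E) (g : ℚ) (A B : Ω → Mat n) where

  E-F-permMat : ∀ {ρ X} → IsPermMat ρ X → E (λ ω → F g (A ω) (B ω) X)
    ≡ E (λ ω → edgeOverlap ρ (A ω) (B ω)) - g * E (λ ω → entrySum (A ω) + entrySum (B ω ᵀ))
  E-F-permMat X≐ρ = trans (E-cong isE λ ω → F-permMat X≐ρ g (A ω) (B ω)) (E-minus-* isE _ g _)

  E-F-mono : ∀ {ρ ρ′ X Y} → IsPermMat ρ X → IsPermMat ρ′ Y →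
    E (λ ω → edgeOverlap ρ (A ω) (B ω)) Q.≤ E (λ ω → edgeOverlap ρ′ (A ω) (B ω)) →
    E (λ ω → F g (A ω) (B ω) X) Q.≤ E (λ ω → F g (A ω) (B ω) Y)
  E-F-mono X≐ρ Y≐ρ′ overlap≤ = subst₂ Q._≤_ (sym (E-F-permMat X≐ρ)) (sym (E-F-permMat Y≐ρ′))
    (ℚ.+-monoˡ-≤ _ overlap≤)

EBit : ℚ → (Bool → ℚ) → ℚ
EBit p φ = p * φ true + (1ℚ - p) * φ false

EBit-isExpectation : ∀ p → IsExpectation (EBit p)
EBit-isExpectation p = record
  { E-cong  = λ φ≗ψ → cong₂ (λ a b → p * a + (1ℚ - p) * b) (φ≗ψ true) (φ≗ψ false)
  ; E-const = solve 2 (λ p c → p :* c :+ (con 1ℚ :- p) :* c := c) refl p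
  ; E-+     = λ φ ψ → solve 5 (λ p a b c d →
                p :* (a :+ b) :+ (con 1ℚ :- p) :* (c :+ d)
                := (p :* a :+ (con 1ℚ :- p) :* c) :+ (p :* b :+ (con 1ℚ :- p) :* d))
              refl p (φ true) (ψ true) (φ false) (ψ false)
  ; E-*ˡ    = λ c φ → solve 4 (λ p c a b →
                p :* (c :* a) :+ (con 1ℚ :- p) :* (c :* b) := c :* (p :* a :+ (con 1ℚ :- p) :* b))
              refl p c (φ true) (φ false)
  }
  where open +-*-Solver

module _ {Ω₁ Ω₂ : Set} {E₁ : (Ω₁ → ℚ) → ℚ} {E₂ : (Ω₂ → ℚ) → ℚ}
         (isE₁ : IsExpectation E₁) (isE₂ : IsExpectation E₂) where

  nested-isExpectation : ∀ {Ω : Set} (_∙_ : Ω₁ → Ω₂ → Ω) →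
    IsExpectation (λ f → E₁ λ x → E₂ λ y → f (x ∙ y))
  nested-isExpectation _∙_ = record
    { E-cong  = λ f≗g → E-cong isE₁ λ x → E-cong isE₂ λ y → f≗g (x ∙ y)
    ; E-const = λ c → trans (E-cong isE₁ λ _ → E-const isE₂ c) (E-const isE₁ c)
    ; E-+     = λ f g → trans (E-cong isE₁ λ x → E-+ isE₂ _ _) (E-+ isE₁ _ _)
    ; E-*ˡ    = λ c f → trans (E-cong isE₁ λ x → E-*ˡ isE₂ c _) (E-*ˡ isE₁ c _)
    }

  E-*-independent : ∀ (h : Ω₁ → ℚ) (g : Ω₂ → ℚ) → (E₁ λ x → E₂ λ y → h x * g y) ≡ E₁ h * E₂ g
  E-*-independent h g = trans (E-cong isE₁ λ x → E-*ˡ isE₂ (h x) g) (E-*ʳ isE₁ (E₂ g) h)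

  E-*-independent′ : ∀ (h : Ω₁ → ℚ) (g : Ω₂ → ℚ) → (E₁ λ x → E₂ λ y → g y * h x) ≡ E₂ g * E₁ h
  E-*-independent′ h g = trans (E-cong isE₁ λ x → E-*ʳ isE₂ (h x) g) (E-*ˡ isE₁ (E₂ g) h)

EBern-isExpectation : ∀ k p → IsExpectation (EBern k p)
EBern-isExpectation zero    p = record
  { E-cong = λ f≗g → f≗g _ ; E-const = λ _ → refl ; E-+ = λ _ _ → refl ; E-*ˡ = λ _ _ → refl }
EBern-isExpectation (suc k) p =
  nested-isExpectation (EBit-isExpectation p) (EBern-isExpectation k p) _∷_

EArr-isExpectation : ∀ r m p → IsExpectation (EArr r m p)
EArr-isExpectation zero    m p = record
  { E-cong = λ f≗g → f≗g _ ; E-const = λ _ → refl ; E-+ = λ _ _ → refl ; E-*ˡ = λ _ _ → refl }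
EArr-isExpectation (suc r) m p =
  nested-isExpectation (EBern-isExpectation m p) (EArr-isExpectation r m p) _∷_

EBern-coord : ∀ k p (y : Fin k) (φ : Bool → ℚ) → EBern k p (λ v → φ (v y)) ≡ EBit p φ
EBern-coord (suc k) p zero    φ =
  E-cong (EBit-isExpectation p) λ β → E-const (EBern-isExpectation k p) (φ β)
EBern-coord (suc k) p (suc y) φ = trans (E-const (EBit-isExpectation p) _) (EBern-coord k p y φ)

EBern-coord₂ : ∀ k p {y y′ : Fin k} → y ≢ y′ → (φ ψ : Bool → ℚ) →
  EBern k p (λ v → φ (v y) * ψ (v y′)) ≡ EBit p φ * EBit p ψ
EBern-coord₂ (suc k) p {zero}  {zero}   y≢y′ φ ψ = ⊥-elim (y≢y′ refl)
EBern-coord₂ (suc k) p {zero}  {suc y′} y≢y′ φ ψ =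
  trans (E-*-independent (EBit-isExpectation p) (EBern-isExpectation k p) φ (λ v → ψ (v y′)))
        (cong (EBit p φ *_) (EBern-coord k p y′ ψ))
EBern-coord₂ (suc k) p {suc y} {zero}   y≢y′ φ ψ =
  trans (E-*-independent′ (EBit-isExpectation p) (EBern-isExpectation k p) ψ (λ v → φ (v y)))
        (cong (_* EBit p ψ) (EBern-coord k p y φ))
EBern-coord₂ (suc k) p {suc y} {suc y′} y≢y′ φ ψ =
  trans (E-const (EBit-isExpectation p) _) (EBern-coord₂ k p (y≢y′ ∘ cong suc) φ ψ)

EArr-entry : ∀ r m p (x : Fin r) (y : Fin m) (φ : Bool → ℚ) →
  EArr r m p (λ b → φ (b x y)) ≡ EBit p φ
EArr-entry (suc r) m p zero y φ =
  trans (E-cong (EBern-isExpectation m p) λ row → E-const (EArr-isExpectation r m p) (φ (row y)))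
        (EBern-coord m p y φ)
EArr-entry (suc r) m p (suc x) y φ =
  trans (E-const (EBern-isExpectation m p) _) (EArr-entry r m p x y φ)

EArr-entry₂ : ∀ r m p {x x′ : Fin r} {y y′ : Fin m} → ¬ (x ≡ x′ × y ≡ y′) →
  (φ ψ : Bool → ℚ) → EArr r m p (λ b → φ (b x y) * ψ (b x′ y′)) ≡ EBit p φ * EBit p ψ
EArr-entry₂ (suc r) m p {zero} {zero} {y} {y′} distinct φ ψ =
  trans (E-cong (EBern-isExpectation m p) λ row →
           E-const (EArr-isExpectation r m p) (φ (row y) * ψ (row y′)))
        (EBern-coord₂ m p (λ y≡y′ → distinct (refl , y≡y′)) φ ψ)
EArr-entry₂ (suc r) m p {zero} {suc x′} {y} {y′} distinct φ ψ =
  trans (E-*-independent (EBern-isExpectation m p) (EArr-isExpectation r m p)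
           (λ row → φ (row y)) (λ b → ψ (b x′ y′)))
        (cong₂ _*_ (EBern-coord m p y φ) (EArr-entry r m p x′ y′ ψ))
EArr-entry₂ (suc r) m p {suc x} {zero} {y} {y′} distinct φ ψ =
  trans (E-*-independent′ (EBern-isExpectation m p) (EArr-isExpectation r m p)
           (λ row → ψ (row y′)) (λ b → φ (b x y)))
        (cong₂ _*_ (EArr-entry r m p x y φ) (EBern-coord m p y′ ψ))
EArr-entry₂ (suc r) m p {suc x} {suc x′} distinct φ ψ =
  trans (E-const (EBern-isExpectation m p) _)
        (EArr-entry₂ r m p (λ (x≡x′ , y≡y′) → distinct (cong suc x≡x′ , y≡y′)) φ ψ)

edge : ∀ {n} → Fin n → Fin n → Maybe (Fin n × Fin n)
edge i j =
  if toℕ i <ᵇ toℕ j then just (i , j) else (if toℕ j <ᵇ toℕ i then just (j , i) else nothing)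

edgeWeight : ∀ {n} → (Fin n → Fin n → Bool) → Maybe (Fin n × Fin n) → ℚ
edgeWeight b nothing        = 0ℚ
edgeWeight b (just (x , y)) = b2q (b x y)

symUpper-edge : ∀ {n} (b : Fin n → Fin n → Bool) i j → symUpper b i j ≡ edgeWeight b (edge i j)
symUpper-edge b i j with toℕ i <ᵇ toℕ j
... | true = refl
... | false with toℕ j <ᵇ toℕ i
...   | true  = refl
...   | false = refl

edge-comm : ∀ {n} (i j : Fin n) → edge i j ≡ edge j i
edge-comm i j with toℕ i <ᵇ toℕ j in i<j | toℕ j <ᵇ toℕ i in j<i
... | true  | true  = ⊥-elim (ℕ.<-asym (ℕ.<ᵇ⇒< (toℕ i) (toℕ j) (subst T (sym i<j) _))
                                      (ℕ.<ᵇ⇒< (toℕ j) (toℕ i) (subst T (sym j<i) _)))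
... | true  | false = refl
... | false | true  = refl
... | false | false = refl

Sample : ℕ → Set
Sample n = (Fin n → Fin n → Bool) × (Fin n → Fin n → Bool)

𝔼 : ∀ n (p q : ℚ) → (Sample n → ℚ) → ℚ
𝔼 n p q f = EArr n n p λ b → EArr n n q λ c → f (b , c)

𝔼-isExpectation : ∀ n p q → IsExpectation (𝔼 n p q)
𝔼-isExpectation n p q =
  nested-isExpectation (EArr-isExpectation n n p) (EArr-isExpectation n n q) _,_

jointEdgeProb : ∀ {n} (p q : ℚ) → Maybe (Fin n × Fin n) → Maybe (Fin n × Fin n) → ℚ
jointEdgeProb {n} p q e e′ =
  𝔼 n p q λ (b , c) → edgeWeight b e * edgeWeight (λ x y → b x y xor c x y) e′

𝔼-G₁*G̃₁ : ∀ n p q (i k a d : Fin n) →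
  𝔼 n p q (λ (b , c) → G₁ b i k * G̃₁ b c a d) ≡ jointEdgeProb p q (edge i k) (edge a d)
𝔼-G₁*G̃₁ n p q i k a d = E-cong (𝔼-isExpectation n p q) λ (b , c) →
  cong₂ _*_ (symUpper-edge b i k) (symUpper-edge (λ x y → b x y xor c x y) a d)

noisy : ℚ → Bool → ℚ
noisy q β = EBit q λ γ → b2q (β xor γ)

EBit-b2q : ∀ p → EBit p b2q ≡ p
EBit-b2q = solve 1 (λ p → p :* con 1ℚ :+ (con 1ℚ :- p) :* con 0ℚ := p) refl
  where open +-*-Solver

EBit-noisy : ∀ p q → EBit p (noisy q) ≡ p * (1ℚ - q) + (1ℚ - p) * q
EBit-noisy = solve 2 (λ p q →
    p :* (q :* con 0ℚ :+ (con 1ℚ :- q) :* con 1ℚ)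
      :+ (con 1ℚ :- p) :* (q :* con 1ℚ :+ (con 1ℚ :- q) :* con 0ℚ)
    := p :* (con 1ℚ :- q) :+ (con 1ℚ :- p) :* q) refl
  where open +-*-Solver

EBit-b2q*noisy : ∀ p q → EBit p (λ β → b2q β * noisy q β) ≡ p * (1ℚ - q)
EBit-b2q*noisy = solve 2 (λ p q →
    p :* (con 1ℚ :* (q :* con 0ℚ :+ (con 1ℚ :- q) :* con 1ℚ))
      :+ (con 1ℚ :- p) :* (con 0ℚ :* (q :* con 1ℚ :+ (con 1ℚ :- q) :* con 0ℚ))
    := p :* (con 1ℚ :- q)) refl
  where open +-*-Solver

jointEdgeProb-just : ∀ {n} p q (x y x′ y′ : Fin n) → jointEdgeProb p q (just (x , y)) (just (x′ , y′))
  ≡ EArr n n p (λ b → b2q (b x y) * noisy q (b x′ y′))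
jointEdgeProb-just {n} p q x y x′ y′ = E-cong (EArr-isExpectation n n p) λ b → begin
  EArr n n q (λ c → b2q (b x y) * b2q (b x′ y′ xor c x′ y′))
    ≡⟨ E-*ˡ (EArr-isExpectation n n q) (b2q (b x y)) _ ⟩
  b2q (b x y) * EArr n n q (λ c → b2q (b x′ y′ xor c x′ y′))
    ≡⟨ cong (b2q (b x y) *_) (EArr-entry n n q x′ y′ (λ γ → b2q (b x′ y′ xor γ))) ⟩
  b2q (b x y) * noisy q (b x′ y′)
    ∎
  where open ≡-Reasoning

jointEdgeProb-same : ∀ {n} p q (x y : Fin n) →
  jointEdgeProb p q (just (x , y)) (just (x , y)) ≡ p * (1ℚ - q)
jointEdgeProb-same {n} p q x y = begin
  jointEdgeProb p q (just (x , y)) (just (x , y))   ≡⟨ jointEdgeProb-just p q x y x y ⟩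
  EArr n n p (λ b → b2q (b x y) * noisy q (b x y))  ≡⟨ EArr-entry n n p x y (λ β → b2q β * noisy q β) ⟩
  EBit p (λ β → b2q β * noisy q β)                  ≡⟨ EBit-b2q*noisy p q ⟩
  p * (1ℚ - q)                                      ∎
  where open ≡-Reasoning

jointEdgeProb-distinct : ∀ {n} p q {x y x′ y′ : Fin n} → ¬ (x ≡ x′ × y ≡ y′) →
  jointEdgeProb p q (just (x , y)) (just (x′ , y′)) ≡ p * (p * (1ℚ - q) + (1ℚ - p) * q)
jointEdgeProb-distinct {n} p q {x} {y} {x′} {y′} distinct = begin
  jointEdgeProb p q (just (x , y)) (just (x′ , y′))   ≡⟨ jointEdgeProb-just p q x y x′ y′ ⟩
  EArr n n p (λ b → b2q (b x y) * noisy q (b x′ y′))  ≡⟨ EArr-entry₂ n n p distinct b2q (noisy q) ⟩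
  EBit p b2q * EBit p (noisy q)                       ≡⟨ cong₂ _*_ (EBit-b2q p) (EBit-noisy p q) ⟩
  p * (p * (1ℚ - q) + (1ℚ - p) * q)                   ∎
  where open ≡-Reasoning

jointEdgeProb-nothingˡ : ∀ {n} p q (e′ : Maybe (Fin n × Fin n)) → jointEdgeProb p q nothing e′ ≡ 0ℚ
jointEdgeProb-nothingˡ {n} p q e′ = trans
  (E-cong isE λ (b , c) → ℚ.*-zeroˡ (edgeWeight (λ x y → b x y xor c x y) e′)) (E-const isE 0ℚ)
  where
  isE : IsExpectation (𝔼 n p q)
  isE = 𝔼-isExpectation n p q

jointEdgeProb-nothingʳ : ∀ {n} p q (e : Maybe (Fin n × Fin n)) → jointEdgeProb p q e nothing ≡ 0ℚ
jointEdgeProb-nothingʳ {n} p q e =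
  trans (E-cong isE λ (b , c) → ℚ.*-zeroʳ (edgeWeight b e)) (E-const isE 0ℚ)
  where
  isE : IsExpectation (𝔼 n p q)
  isE = 𝔼-isExpectation n p q

p≤q⇒0≤q-p : ∀ {p q} → p Q.≤ q → 0ℚ Q.≤ q - p
p≤q⇒0≤q-p {p} {q} p≤q = subst (Q._≤ q - p) (ℚ.+-inverseʳ p) (ℚ.+-monoˡ-≤ (- p) p≤q)

0≤q-p⇒p≤q : ∀ {p q} → 0ℚ Q.≤ q - p → p Q.≤ q
0≤q-p⇒p≤q {p} {q} 0≤q-p =
  subst₂ Q._≤_ (ℚ.+-identityˡ p) (solve 2 (λ p q → (q :- p) :+ p := q) refl p q) (ℚ.+-monoˡ-≤ p 0≤q-p)
  where open +-*-Solver

*-nonNeg : ∀ {p q} → 0ℚ Q.≤ p → 0ℚ Q.≤ q → 0ℚ Q.≤ p * q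
*-nonNeg {p} {q} 0≤p 0≤q =
  ℚ.nonNegative⁻¹ (p * q) {{ℚ.nonNeg*nonNeg⇒nonNeg p {{nonNegative 0≤p}} q {{nonNegative 0≤q}}}}

½≤1 : ½ Q.≤ 1ℚ
½≤1 = from-yes (½ ℚ.≤? 1ℚ)

noisy-agreement-≤ : ∀ {p q} → 0ℚ Q.≤ p → p Q.≤ 1ℚ → q Q.≤ ½ →
  p * (p * (1ℚ - q) + (1ℚ - p) * q) Q.≤ p * (1ℚ - q)
noisy-agreement-≤ {p} {q} 0≤p p≤1 q≤½ = 0≤q-p⇒p≤q (subst (0ℚ Q.≤_) gap
  (*-nonNeg 0≤p (*-nonNeg (p≤q⇒0≤q-p p≤1) (p≤q⇒0≤q-p (ℚ.+-mono-≤ q≤½ q≤½)))))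
  where
  open +-*-Solver
  gap : p * ((1ℚ - p) * (1ℚ - (q + q))) ≡ p * (1ℚ - q) - p * (p * (1ℚ - q) + (1ℚ - p) * q)
  gap = solve 2 (λ p q → p :* ((con 1ℚ :- p) :* (con 1ℚ :- (q :+ q)))
    := p :* (con 1ℚ :- q) :- p :* (p :* (con 1ℚ :- q) :+ (con 1ℚ :- p) :* q)) refl p q

jointEdgeProb-≤-same : ∀ {n} {p q} → 0ℚ Q.≤ p → p Q.≤ 1ℚ → q Q.≤ ½ →
  ∀ (e e′ : Maybe (Fin n × Fin n)) → jointEdgeProb p q e e′ Q.≤ jointEdgeProb p q e e
jointEdgeProb-≤-same {n} {p} {q} 0≤p p≤1 q≤½ nothing e′ =
  ℚ.≤-reflexive (trans (jointEdgeProb-nothingˡ p q e′) (sym (jointEdgeProb-nothingˡ {n} p q nothing)))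
jointEdgeProb-≤-same {n} {p} {q} 0≤p p≤1 q≤½ (just (x , y)) nothing =
  subst₂ Q._≤_ (sym (jointEdgeProb-nothingʳ p q (just (x , y)))) (sym (jointEdgeProb-same p q x y))
    (*-nonNeg 0≤p (p≤q⇒0≤q-p (ℚ.≤-trans q≤½ ½≤1)))
jointEdgeProb-≤-same {n} {p} {q} 0≤p p≤1 q≤½ (just (x , y)) (just (x′ , y′))
  with ×-≡-dec _≟_ _≟_ (x , y) (x′ , y′)
... | yes refl = ℚ.≤-refl
... | no xy≢x′y′ = subst₂ Q._≤_
  (sym (jointEdgeProb-distinct p q {x} {y} {x′} {y′}
    λ (x≡x′ , y≡y′) → xy≢x′y′ (cong₂ _,_ x≡x′ y≡y′)))
  (sym (jointEdgeProb-same p q x y))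
  (noisy-agreement-≤ 0≤p p≤1 q≤½)

𝔼-edgeOverlap : ∀ n p q (σ ρ : Permutation′ n) →
  𝔼 n p q (λ (b , c) → edgeOverlap ρ (G₁ b) (G₂ (permMat σ) b c))
  ≡ Σ λ i → Σ λ k → jointEdgeProb p q (edge i k) (edge (σ ⟨$⟩ʳ (ρ ⟨$⟩ʳ k)) (σ ⟨$⟩ʳ (ρ ⟨$⟩ʳ i)))
𝔼-edgeOverlap n p q σ ρ = begin
  𝔼 n p q (λ (b , c) → Σ λ i → Σ λ k → G₁ b i k * G₂ (permMat σ) b c (ρ ⟨$⟩ʳ k) (ρ ⟨$⟩ʳ i))
    ≡⟨ E-cong isE (λ (b , c) → Σ-cong λ i → Σ-cong λ k → cong (G₁ b i k *_)
         (conj-permMat (permMat-isPermMat σ) (G̃₁ b c) (ρ ⟨$⟩ʳ k) (ρ ⟨$⟩ʳ i))) ⟩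
  𝔼 n p q (λ (b , c) → Σ λ i → Σ λ k → G₁ b i k * G̃₁ b c (σρ k) (σρ i))
    ≡⟨ E-Σ isE {n} _ ⟩
  (Σ λ i → 𝔼 n p q (λ (b , c) → Σ λ k → G₁ b i k * G̃₁ b c (σρ k) (σρ i)))
    ≡⟨ Σ-cong {n} (λ i → E-Σ isE {n} _) ⟩
  (Σ λ i → Σ λ k → 𝔼 n p q (λ (b , c) → G₁ b i k * G̃₁ b c (σρ k) (σρ i)))
    ≡⟨ Σ-cong (λ i → Σ-cong λ k → 𝔼-G₁*G̃₁ n p q i k (σρ k) (σρ i)) ⟩
  (Σ λ i → Σ λ k → jointEdgeProb p q (edge i k) (edge (σρ k) (σρ i)))
    ∎
  where
  open ≡-Reasoning
  isE : IsExpectation (𝔼 n p q)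
  isE = 𝔼-isExpectation n p q
  σρ : Fin n → Fin n
  σρ k = σ ⟨$⟩ʳ (ρ ⟨$⟩ʳ k)

𝔼-edgeOverlap-≤ : ∀ n {p q} → 0ℚ Q.≤ p → p Q.≤ 1ℚ → q Q.≤ ½ → (σ ρ : Permutation′ n) →
  𝔼 n p q (λ (b , c) → edgeOverlap ρ (G₁ b) (G₂ (permMat σ) b c))
  Q.≤ 𝔼 n p q (λ (b , c) → edgeOverlap (flip σ) (G₁ b) (G₂ (permMat σ) b c))
𝔼-edgeOverlap-≤ n {p} {q} 0≤p p≤1 q≤½ σ ρ = begin
  𝔼 n p q (λ (b , c) → edgeOverlap ρ (G₁ b) (G₂ (permMat σ) b c))
    ≡⟨ 𝔼-edgeOverlap n p q σ ρ ⟩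
  (Σ {n} λ i → Σ {n} λ k → jointEdgeProb p q (edge i k) (edge (σρ k) (σρ i)))
    ≤⟨ Σ-mono {n} (λ i → Σ-mono {n} λ k →
         jointEdgeProb-≤-same 0≤p p≤1 q≤½ (edge i k) (edge (σρ k) (σρ i))) ⟩
  (Σ {n} λ i → Σ {n} λ k → jointEdgeProb p q (edge i k) (edge i k))
    ≡⟨ Σ-cong {n} (λ i → Σ-cong {n} λ k → cong (jointEdgeProb p q (edge i k)) edge-σσ⁻¹) ⟨
  (Σ {n} λ i → Σ {n} λ k → jointEdgeProb p q (edge i k) (edge (σσ⁻¹ k) (σσ⁻¹ i)))
    ≡⟨ 𝔼-edgeOverlap n p q σ (flip σ) ⟨
  𝔼 n p q (λ (b , c) → edgeOverlap (flip σ) (G₁ b) (G₂ (permMat σ) b c))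
    ∎
  where
  open ℚ.≤-Reasoning
  σρ σσ⁻¹ : Fin n → Fin n
  σρ k = σ ⟨$⟩ʳ (ρ ⟨$⟩ʳ k)
  σσ⁻¹ k = σ ⟨$⟩ʳ (σ ⟨$⟩ˡ k)
  edge-σσ⁻¹ : ∀ {i k} → edge (σσ⁻¹ k) (σσ⁻¹ i) ≡ edge i k
  edge-σσ⁻¹ {i} {k} = trans (cong₂ edge (inverseʳ σ) (inverseʳ σ)) (edge-comm k i)

lemma2 : (n : ℕ) → 2 ≤ n → (p q s₁ s₂ s₃ : ℚ) →
    0ℚ < p → p < ½ → 0ℚ Q.≤ q → q < ½ →
    s₂ < s₁ → s₃ < s₂ → 0ℚ < s₃ →
    (σ : Permutation′ n) → (π : Permutation′ n) →
    EF n p q s₁ s₂ s₃ (permMat σ) (permMat π)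
      Q.≤ EF n p q s₁ s₂ s₃ (permMat σ) (permMat σ ᵀ)
lemma2 n _ p q s₁ s₂ s₃ 0<p p<½ _ q<½ _ _ _ σ π =
  E-F-mono (𝔼-isExpectation n p q) (γ s₁ s₂ s₃) (λ (b , _) → G₁ b) (λ (b , c) → G₂ (permMat σ) b c)
    (permMat-isPermMat π) (ᵀ-isPermMat (permMat-isPermMat σ))
    (𝔼-edgeOverlap-≤ n (ℚ.<⇒≤ 0<p) (ℚ.≤-trans (ℚ.<⇒≤ p<½) ½≤1) (ℚ.<⇒≤ q<½) σ π)
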